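{- If $x$ is a short number, then there exists a Digraph placement game $G$ with $G=x$.
   Context: All games are short normal-play two-player combinatorial games (Left and Right; finitely many positions reachable, bounded play length, a player unable to move loses), written $\{\text{Left options}\mid\text{Right options}\}$. The disjunctive sum $X+Y$ is the game in which each move is a move in exactly one of the components. Games $Y,Z$ are equal, $Y=Z$, if for every game $X$ the sums $X+Y$ and $X+Z$ have the same outcome (Left wins / Right wins / next player wins / previous player wins). $X\ge Y$ means Left wins $X-Y$ moving second, where $-X$ swaps the roles of the players; $X<Y$ etc. accordingly. A game $X$ is a number if every Left option $X^L$ and every Right option $X^R$ satisfy $X^L<X^R$ (short numbers correspond to dyadic rationals). A Digraph placement game is played on a finite digraph with vertices coloured blue/red (not necessarily properly): Left chooses a remaining blue vertex and deletes it together with its out-neighbours, Right does the same with a red vertex; a player unable to move loses. -}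

module Defs where

open import Data.Nat using (ℕ; zero; suc)
open import Data.Bool using (Bool; true; false; _∧_; _∨_; not)
open import Data.Fin using (Fin) renaming (_≟_ to _≟F_)
open import Data.Vec using (Vec; lookup; tabulate; replicate)
open import Data.List using (List; []; _∷_; _++_; map; filterᵇ; allFin)
open import Data.List.Membership.Propositional using (_∈_)
open import Data.List.Relation.Unary.All using (All)
open import Data.Product using (_×_; Σ; _,_)
open import Relation.Nullary using (¬_; does)
open import Function.Bundles using (_⇔_)

-- Short games: { Left options | Right options }, finitely many options,
-- well-founded (hence finitely many positions, bounded play length).

data Game : Set where
  ⟨_∣_⟩ : List Game → List Game → Game

leftOpts : Game → List Game
leftOpts ⟨ l ∣ r ⟩ = l

rightOpts : Game → List Game
rightOpts ⟨ l ∣ r ⟩ = r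

mutual
  data LWinsFirst (G : Game) : Set where
    lmove : ∀ {GL} → GL ∈ leftOpts G → LWinsSecond GL → LWinsFirst G

  data LWinsSecond (G : Game) : Set where
    lrespond : (∀ {GR} → GR ∈ rightOpts G → LWinsFirst GR) → LWinsSecond G

mutual
  data RWinsFirst (G : Game) : Set where
    rmove : ∀ {GR} → GR ∈ rightOpts G → RWinsSecond GR → RWinsFirst G

  data RWinsSecond (G : Game) : Set where
    rrespond : (∀ {GL} → GL ∈ leftOpts G → RWinsFirst GL) → RWinsSecond G

-- Same outcome class (L / R / N / P): the outcome class is determined by
-- who wins when Left starts and who wins when Right starts.
SameOutcome : Game → Game → Set
SameOutcome G H =
  (LWinsFirst G ⇔ LWinsFirst H) × (LWinsSecond G ⇔ LWinsSecond H) ×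
  (RWinsFirst G ⇔ RWinsFirst H) × (RWinsSecond G ⇔ RWinsSecond H)

mutual
  _+_ : Game → Game → Game
  G@(⟨ a ∣ b ⟩) + H@(⟨ c ∣ d ⟩) =
    ⟨ sumL a H ++ sumR G c ∣ sumL b H ++ sumR G d ⟩

  sumL : List Game → Game → List Game
  sumL [] H = []
  sumL (g ∷ gs) H = (g + H) ∷ sumL gs H

  sumR : Game → List Game → List Game
  sumR G [] = []
  sumR G (h ∷ hs) = (G + h) ∷ sumR G hs

infixl 6 _+_

mutual
  -_ : Game → Game
  - ⟨ a ∣ b ⟩ = ⟨ negs b ∣ negs a ⟩

  negs : List Game → List Game
  negs [] = []
  negs (g ∷ gs) = (- g) ∷ negs gs

_≈G_ : Game → Game → Set
Y ≈G Z = (X : Game) → SameOutcome (X + Y) (X + Z)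

_≥G_ : Game → Game → Set
X ≥G Y = LWinsSecond (X + (- Y))

_≤G_ : Game → Game → Set
X ≤G Y = Y ≥G X

_<G_ : Game → Game → Set
X <G Y = (X ≤G Y) × ¬ (Y ≤G X)

data IsNumber : Game → Set where
  number : ∀ {ls rs} → All IsNumber ls → All IsNumber rs →
           (∀ {a b} → a ∈ ls → b ∈ rs → a <G b) → IsNumber ⟨ ls ∣ rs ⟩

data Colour : Set where
  blue red : Colour

_==C_ : Colour → Colour → Bool
blue ==C blue = true
red  ==C red  = true
_    ==C _    = false

record Digraph : Set where
  field
    n      : ℕ
    colour : Fin n → Colour
    arc    : Fin n → Fin n → Bool   -- arc v u : there is an arc v → u

module _ (D : Digraph) where
  open Digraph D

  Remaining : Set
  Remaining = Vec Bool n

  delete : Fin n → Remaining → Remaining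
  delete v S = tabulate λ u → lookup S u ∧ not (does (u ≟F v) ∨ arc v u)

  playable : Colour → Remaining → List (Fin n)
  playable c S = filterᵇ (λ v → lookup S v ∧ (colour v ==C c)) (allFin n)

  -- The fuel k is an upper bound on the number of
  -- moves still possible; every move deletes at least one vertex, so
  -- fuel n from the full vertex set is never exhausted prematurely.
  position : ℕ → Remaining → Game
  position zero S = ⟨ [] ∣ [] ⟩
  position (suc k) S =
    ⟨ map (λ v → position k (delete v S)) (playable blue S)
    ∣ map (λ v → position k (delete v S)) (playable red S) ⟩

  digraphGame : Game
  digraphGame = position n (replicate n true)

-- Every short number equals a blue-red Hackenbush stalk, and stalks are digraph placement
-- games. For a number x = {ls | rs}, by induction every option equals a stalk; let lo be the
-- greatest string of a Left option and hi the least string of a Right option (lo < hi since x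
-- is a number). The simplest string s strictly between lo and hi has every Left option (a
-- prefix followed by a blue edge) at most lo and every Right option at least hi, so Left and
-- Right each have an answer to every move in x - stalk s: x equals stalk s. Comparison of
-- stalks is the sign-expansion order, proved by the usual mutual induction on options.
-- Finally the stalk s is the placement game on vertices 0 … |s|-1 coloured by s with an arc
-- from each vertex to every vertex above it: the two games are bisimilar.
module Submission where

open import Defs
open import Data.Bool using (Bool; true; false; T; _∧_; _∨_; not)
open import Data.Bool.Properties using (T-∧; T-≡; ∨-zeroʳ; ∧-zeroʳ)
open import Data.Empty using (⊥-elim)
open import Data.Fin as Fin using (Fin; toℕ) renaming (_≟_ to _≟ᶠ_)
open import Data.Fin.Properties using (toℕ<n; <⇒≢)
open import Data.List
  using (List; []; _∷_; _++_; _∷ʳ_; map; reverse; length; lookup; take; allFin)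
open import Data.List.Properties using (unfold-reverse; reverse-involutive; take-all)
open import Data.List.Membership.Propositional using (_∈_; find)
open import Data.List.Membership.Propositional.Properties
  using (∈-++⁺ˡ; ∈-++⁺ʳ; ∈-++⁻; ∈-map⁺; ∈-map⁻; ∈-filter⁺; ∈-filter⁻; ∈-allFin)
open import Data.List.Relation.Unary.All as All using (All; []; _∷_)
open import Data.List.Relation.Unary.Any using (Any; here; there)
open import Data.Nat
  using (ℕ; zero; suc; _≤_; _<_; z≤n; s≤s⁻¹; z<s; s<s; _<ᵇ_; _≤ᵇ_; _<?_)
  renaming (_+_ to _+ℕ_)
open import Data.Nat.Induction using (<-wellFounded)
open import Data.Nat.Properties
  using (+-monoˡ-<; +-monoʳ-<; <ᵇ⇒<; <⇒<ᵇ; ≤ᵇ⇒≤; ≤⇒≤ᵇ; <⇒≱; ≮⇒≥; <-trans; ≤-trans; ≤-refl)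
open import Data.Product using (Σ; _×_; _,_; proj₁; proj₂)
open import Data.Sum as Sum using (_⊎_; inj₁; inj₂)
open import Data.Unit using (⊤; tt)
open import Data.Vec as Vec using (Vec; tabulate; replicate)
open import Data.Vec.Properties
  using (lookup∘tabulate; tabulate∘lookup; tabulate-cong; lookup-replicate)
open import Function.Bundles using (Equivalence; mk⇔)
open import Induction.WellFounded using (Acc; acc)
open import Relation.Nullary using (¬_; does; yes; no)
open import Relation.Nullary.Decidable using (T?; dec-false)
open import Relation.Binary.PropositionalEquality
  using (_≡_; refl; sym; trans; cong; cong₂; subst; respˡ; respʳ)
import Relation.Binary.Construct.StrictToNonStrict as StrictToNonStrict

sumL≡map : ∀ gs H → sumL gs H ≡ map (_+ H) gs
sumL≡map []       H = refl
sumL≡map (g ∷ gs) H = cong (g + H ∷_) (sumL≡map gs H)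

sumR≡map : ∀ G hs → sumR G hs ≡ map (G +_) hs
sumR≡map G []       = refl
sumR≡map G (h ∷ hs) = cong (G + h ∷_) (sumR≡map G hs)

negs≡map : ∀ gs → negs gs ≡ map -_ gs
negs≡map []       = refl
negs≡map (g ∷ gs) = cong (- g ∷_) (negs≡map gs)

OptionsOfSum : (Game → List Game) → Set
OptionsOfSum opts = ∀ G H → opts (G + H) ≡ map (_+ H) (opts G) ++ map (G +_) (opts H)

leftOpts-+ : OptionsOfSum leftOpts
leftOpts-+ ⟨ a ∣ b ⟩ ⟨ c ∣ d ⟩ = cong₂ _++_ (sumL≡map a _) (sumR≡map _ c)

rightOpts-+ : OptionsOfSum rightOpts
rightOpts-+ ⟨ a ∣ b ⟩ ⟨ c ∣ d ⟩ = cong₂ _++_ (sumL≡map b _) (sumR≡map _ d)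

data SumOption (opts : Game → List Game) (G H : Game) : Game → Set where
  inˡ : ∀ {G′} → G′ ∈ opts G → SumOption opts G H (G′ + H)
  inʳ : ∀ {H′} → H′ ∈ opts H → SumOption opts G H (G + H′)

module SumOptions (opts : Game → List Game) (opts-+ : OptionsOfSum opts) where

  ∈-+⁺ˡ : ∀ G H {G′} → G′ ∈ opts G → G′ + H ∈ opts (G + H)
  ∈-+⁺ˡ G H m = subst (_ ∈_) (sym (opts-+ G H)) (∈-++⁺ˡ (∈-map⁺ (_+ H) m))

  ∈-+⁺ʳ : ∀ G H {H′} → H′ ∈ opts H → G + H′ ∈ opts (G + H)
  ∈-+⁺ʳ G H m =
    subst (_ ∈_) (sym (opts-+ G H)) (∈-++⁺ʳ (map (_+ H) (opts G)) (∈-map⁺ (G +_) m))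

  ∈-+⁻ : ∀ G H {X} → X ∈ opts (G + H) → SumOption opts G H X
  ∈-+⁻ G H m with ∈-++⁻ (map (_+ H) (opts G)) (subst (_ ∈_) (opts-+ G H) m)
  ... | inj₁ m′ with ∈-map⁻ (_+ H) m′
  ...   | _ , m″ , refl = inˡ m″
  ∈-+⁻ G H m | inj₂ m′ with ∈-map⁻ (G +_) m′
  ...   | _ , m″ , refl = inʳ m″

module Left  = SumOptions leftOpts  leftOpts-+
module Right = SumOptions rightOpts rightOpts-+

data Negated (gs : List Game) : Game → Set where
  negated : ∀ {g} → g ∈ gs → Negated gs (- g)

∈-negs⁺ : ∀ {gs g} → g ∈ gs → - g ∈ negs gs
∈-negs⁺ {gs} m = subst (_ ∈_) (sym (negs≡map gs)) (∈-map⁺ -_ m)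

∈-negs⁻ : ∀ gs {X} → X ∈ negs gs → Negated gs X
∈-negs⁻ gs m with ∈-map⁻ -_ (subst (_ ∈_) (negs≡map gs) m)
... | _ , m′ , refl = negated m′

∈-negˡ⁺ : ∀ G {G′} → G′ ∈ rightOpts G → - G′ ∈ leftOpts (- G)
∈-negˡ⁺ ⟨ _ ∣ _ ⟩ = ∈-negs⁺

∈-negʳ⁺ : ∀ G {G′} → G′ ∈ leftOpts G → - G′ ∈ rightOpts (- G)
∈-negʳ⁺ ⟨ _ ∣ _ ⟩ = ∈-negs⁺

∈-negˡ⁻ : ∀ G {X} → X ∈ leftOpts (- G) → Negated (rightOpts G) X
∈-negˡ⁻ ⟨ _ ∣ b ⟩ = ∈-negs⁻ b

∈-negʳ⁻ : ∀ G {X} → X ∈ rightOpts (- G) → Negated (leftOpts G) X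
∈-negʳ⁻ ⟨ a ∣ _ ⟩ = ∈-negs⁻ a

mutual
  neg-involutive : ∀ G → - (- G) ≡ G
  neg-involutive ⟨ a ∣ b ⟩ = cong₂ ⟨_∣_⟩ (negs-involutive a) (negs-involutive b)

  negs-involutive : ∀ gs → negs (negs gs) ≡ gs
  negs-involutive []       = refl
  negs-involutive (g ∷ gs) = cong₂ _∷_ (neg-involutive g) (negs-involutive gs)

data DifferenceOption (optsH optsG : Game → List Game) (H G : Game) : Game → Set where
  minuend    : ∀ {H′} → H′ ∈ optsH H → DifferenceOption optsH optsG H G (H′ + - G)
  subtrahend : ∀ {G′} → G′ ∈ optsG G → DifferenceOption optsH optsG H G (H + - G′)

leftOpts-diff⁻ : ∀ H G {X} → X ∈ leftOpts (H + - G) → DifferenceOption leftOpts rightOpts H G X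
leftOpts-diff⁻ H G m with Left.∈-+⁻ H (- G) m
... | inˡ mH = minuend mH
... | inʳ mG with ∈-negˡ⁻ G mG
...   | negated mG′ = subtrahend mG′

rightOpts-diff⁻ : ∀ H G {X} → X ∈ rightOpts (H + - G) → DifferenceOption rightOpts leftOpts H G X
rightOpts-diff⁻ H G m with Right.∈-+⁻ H (- G) m
... | inˡ mH = minuend mH
... | inʳ mG with ∈-negʳ⁻ G mG
...   | negated mG′ = subtrahend mG′

all⊎any : ∀ {P Q : Game → Set} {gs} → All (λ g → P g ⊎ Q g) gs → All P gs ⊎ Any Q gs
all⊎any []             = inj₁ []
all⊎any (inj₁ p ∷ pqs) = Sum.map (p ∷_) there (all⊎any pqs)
all⊎any (inj₂ q ∷ _)   = inj₂ (here q)

Determined : Game → Set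
Determined G = (LWinsFirst G ⊎ RWinsSecond G) × (RWinsFirst G ⊎ LWinsSecond G)

mutual
  determined : ∀ G → Determined G
  determined ⟨ ls ∣ rs ⟩ = leftStarts (all⊎any (All.map proj₂ (determineds ls)))
                         , rightStarts (all⊎any (All.map proj₁ (determineds rs)))
    where
    leftStarts : All RWinsFirst ls ⊎ Any LWinsSecond ls →
                 LWinsFirst ⟨ ls ∣ rs ⟩ ⊎ RWinsSecond ⟨ ls ∣ rs ⟩
    leftStarts (inj₁ all) = inj₂ (rrespond (All.lookup all))
    leftStarts (inj₂ any) = let _ , m , w = find any in inj₁ (lmove m w)

    rightStarts : All LWinsFirst rs ⊎ Any RWinsSecond rs →
                  RWinsFirst ⟨ ls ∣ rs ⟩ ⊎ LWinsSecond ⟨ ls ∣ rs ⟩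
    rightStarts (inj₁ all) = inj₂ (lrespond (All.lookup all))
    rightStarts (inj₂ any) = let _ , m , w = find any in inj₁ (rmove m w)

  determineds : ∀ gs → All Determined gs
  determineds []       = []
  determineds (g ∷ gs) = determined g ∷ determineds gs

mutual
  RWinsFirst⇒¬LWinsSecond : ∀ {G} → RWinsFirst G → ¬ LWinsSecond G
  RWinsFirst⇒¬LWinsSecond (rmove m w) (lrespond f) = LWinsFirst⇒¬RWinsSecond (f m) w

  LWinsFirst⇒¬RWinsSecond : ∀ {G} → LWinsFirst G → ¬ RWinsSecond G
  LWinsFirst⇒¬RWinsSecond (lmove m w) (rrespond f) = RWinsFirst⇒¬LWinsSecond (f m) w

infix 4 _⧐_ _≃_

-- H ⧐ G: H is greater than or confused with G.
_⧐_ : Game → Game → Set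
H ⧐ G = LWinsFirst (H + - G)

_≃_ : Game → Game → Set
G ≃ H = G ≥G H × H ≥G G

mutual
  LWinsFirst-comm : ∀ G H → LWinsFirst (G + H) → LWinsFirst (H + G)
  LWinsFirst-comm G H (lmove m w) with Left.∈-+⁻ G H m
  ... | inˡ {G′} mG = lmove (Left.∈-+⁺ʳ H G mG) (LWinsSecond-comm G′ H w)
  ... | inʳ {H′} mH = lmove (Left.∈-+⁺ˡ H G mH) (LWinsSecond-comm G H′ w)

  LWinsSecond-comm : ∀ G H → LWinsSecond (G + H) → LWinsSecond (H + G)
  LWinsSecond-comm G H (lrespond f) = lrespond respond
    where
    respond : ∀ {X} → X ∈ rightOpts (H + G) → LWinsFirst X
    respond m with Right.∈-+⁻ H G m
    ... | inˡ {H′} mH = LWinsFirst-comm G H′ (f (Right.∈-+⁺ʳ G H mH))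
    ... | inʳ {G′} mG = LWinsFirst-comm G′ H (f (Right.∈-+⁺ˡ G H mG))

-- Left's winning move to X + G^L is replaced using H ⧐ G^L: by a move to X + H^L, or by
-- waiting for Right's reply X + G^LR. The recursion is on the win in X + G or, where that
-- win is unchanged, on the proof of H ≥ G.
mutual
  ≥-monoʳ-LWinsFirst : ∀ X {G H} → H ≥G G → LWinsFirst (X + G) → LWinsFirst (X + H)
  ≥-monoʳ-LWinsFirst X {G} {H} H≥G@(lrespond H≥G-respond) (lmove m w) with Left.∈-+⁻ X G m
  ... | inˡ {X′} mX = lmove (Left.∈-+⁺ˡ X H mX) (≥-monoʳ-LWinsSecond X′ H≥G w)
  ... | inʳ {GL} mG with H≥G-respond (Right.∈-+⁺ʳ H (- G) (∈-negʳ⁺ G mG))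
  ...   | lmove m′ w′ with leftOpts-diff⁻ H GL m′
  ...     | minuend mH = lmove (Left.∈-+⁺ʳ X H mH) (≥-monoʳ-LWinsSecond X w′ w)
  ...     | subtrahend mGLR with w
  ...       | lrespond f = ≥-monoʳ-LWinsFirst X w′ (f (Right.∈-+⁺ʳ X GL mGLR))

  ≥-monoʳ-LWinsSecond : ∀ X {G H} → H ≥G G → LWinsSecond (X + G) → LWinsSecond (X + H)
  ≥-monoʳ-LWinsSecond X {G} {H} H≥G@(lrespond H≥G-respond) (lrespond f) = lrespond respond
    where
    respond : ∀ {Y} → Y ∈ rightOpts (X + H) → LWinsFirst Y
    respond m with Right.∈-+⁻ X H m
    ... | inˡ {X′} mX = ≥-monoʳ-LWinsFirst X′ H≥G (f (Right.∈-+⁺ˡ X G mX))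
    ... | inʳ {HR} mH with H≥G-respond (Right.∈-+⁺ˡ H (- G) mH)
    ...   | lmove m′ w′ with leftOpts-diff⁻ HR G m′
    ...     | minuend mHRL = lmove (Left.∈-+⁺ʳ X HR mHRL) (≥-monoʳ-LWinsSecond X w′ (lrespond f))
    ...     | subtrahend mGR = ≥-monoʳ-LWinsFirst X w′ (f (Right.∈-+⁺ʳ X G mGR))

-- Right's transfers are the contrapositives of Left's, by determinacy.
≥-monoʳ-RWinsFirst : ∀ X {G H} → H ≥G G → RWinsFirst (X + H) → RWinsFirst (X + G)
≥-monoʳ-RWinsFirst X {G} H≥G r with proj₂ (determined (X + G))
... | inj₁ r′ = r′
... | inj₂ l  = ⊥-elim (RWinsFirst⇒¬LWinsSecond r (≥-monoʳ-LWinsSecond X H≥G l))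

≥-monoʳ-RWinsSecond : ∀ X {G H} → H ≥G G → RWinsSecond (X + H) → RWinsSecond (X + G)
≥-monoʳ-RWinsSecond X {G} H≥G r with proj₁ (determined (X + G))
... | inj₁ l  = ⊥-elim (LWinsFirst⇒¬RWinsSecond (≥-monoʳ-LWinsFirst X H≥G l) r)
... | inj₂ r′ = r′

≃⇒≈ : ∀ {G H} → G ≃ H → G ≈G H
≃⇒≈ (G≥H , H≥G) X =
  mk⇔ (≥-monoʳ-LWinsFirst X H≥G)  (≥-monoʳ-LWinsFirst X G≥H)  ,
  mk⇔ (≥-monoʳ-LWinsSecond X H≥G) (≥-monoʳ-LWinsSecond X G≥H) ,
  mk⇔ (≥-monoʳ-RWinsFirst X G≥H)  (≥-monoʳ-RWinsFirst X H≥G)  ,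
  mk⇔ (≥-monoʳ-RWinsSecond X G≥H) (≥-monoʳ-RWinsSecond X H≥G)

≥-trans : ∀ {A B C} → A ≥G B → B ≥G C → A ≥G C
≥-trans {A} {B} {C} A≥B B≥C =
  LWinsSecond-comm (- C) A (≥-monoʳ-LWinsSecond (- C) A≥B (LWinsSecond-comm B (- C) B≥C))

≥-⧐-trans : ∀ {A B C} → A ≥G B → B ⧐ C → A ⧐ C
≥-⧐-trans {A} {B} {C} A≥B B⧐C =
  LWinsFirst-comm (- C) A (≥-monoʳ-LWinsFirst (- C) A≥B (LWinsFirst-comm B (- C) B⧐C))

neg-antitone : ∀ {B C} → B ≥G C → (- C) ≥G (- B)
neg-antitone {B} {C} B≥C =
  subst (λ X → LWinsSecond (- C + X)) (sym (neg-involutive B)) (LWinsSecond-comm B (- C) B≥C)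

⧐-≥-trans : ∀ {A B C} → A ⧐ B → B ≥G C → A ⧐ C
⧐-≥-trans {A} A⧐B B≥C = ≥-monoʳ-LWinsFirst A (neg-antitone B≥C) A⧐B

≃-trans : ∀ {A B C} → A ≃ B → B ≃ C → A ≃ C
≃-trans (A≥B , B≥A) (B≥C , C≥B) = ≥-trans A≥B B≥C , ≥-trans C≥B B≥A

≃-sym : ∀ {G H} → G ≃ H → H ≃ G
≃-sym (G≥H , H≥G) = H≥G , G≥H

⧐-via-leftOpt : ∀ H G {HL} → HL ∈ leftOpts H → HL ≥G G → H ⧐ G
⧐-via-leftOpt H G m = lmove (Left.∈-+⁺ˡ H (- G) m)

⧐-via-rightOpt : ∀ H G {GR} → GR ∈ rightOpts G → H ≥G GR → H ⧐ G
⧐-via-rightOpt H G m = lmove (Left.∈-+⁺ʳ H (- G) (∈-negˡ⁺ G m))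

≥-intro : ∀ H G → (∀ {GL} → GL ∈ leftOpts G → H ⧐ GL) →
          (∀ {HR} → HR ∈ rightOpts H → HR ⧐ G) → H ≥G G
≥-intro H G H⧐GL HR⧐G = lrespond respond
  where
  respond : ∀ {X} → X ∈ rightOpts (H + - G) → LWinsFirst X
  respond m with rightOpts-diff⁻ H G m
  ... | minuend mH    = HR⧐G mH
  ... | subtrahend mG = H⧐GL mG

-- true is Left (blue), false is Right (red).
options : Bool → Game → List Game
options true  = leftOpts
options false = rightOpts

data _∼_ (P Q : Game) : Set where
  bisim : (∀ b {P′} → P′ ∈ options b P → Σ Game λ Q′ → Q′ ∈ options b Q × P′ ∼ Q′) →
          (∀ b {Q′} → Q′ ∈ options b Q → Σ Game λ P′ → P′ ∈ options b P × P′ ∼ Q′) →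
          P ∼ Q

∼⇒≃ : ∀ {P Q} → P ∼ Q → P ≃ Q
∼⇒≃ {P} {Q} (bisim forth back) =
  ≥-intro P Q (λ m → let _ , m′ , s = back true m   in ⧐-via-leftOpt  P _ m′ (proj₁ (∼⇒≃ s)))
              (λ m → let _ , m′ , s = forth false m in ⧐-via-rightOpt _ Q m′ (proj₁ (∼⇒≃ s))) ,
  ≥-intro Q P (λ m → let _ , m′ , s = forth true m  in ⧐-via-leftOpt  Q _ m′ (proj₂ (∼⇒≃ s)))
              (λ m → let _ , m′ , s = back false m  in ⧐-via-rightOpt _ P m′ (proj₂ (∼⇒≃ s)))

-- Hackenbush stalks

-- A stalk listed from the top edge down: the head is the edge that is removed alone.
stalkᵀ : List Bool → Game
stalkᵀ []          = ⟨ [] ∣ [] ⟩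
stalkᵀ (true ∷ r)  = ⟨ stalkᵀ r ∷ leftOpts (stalkᵀ r) ∣ rightOpts (stalkᵀ r) ⟩
stalkᵀ (false ∷ r) = ⟨ leftOpts (stalkᵀ r) ∣ stalkᵀ r ∷ rightOpts (stalkᵀ r) ⟩

-- A stalk listed from the ground up.
stalk : List Bool → Game
stalk s = stalkᵀ (reverse s)

-- Cutting an edge of colour b removes it and everything above, leaving r′ (top-down
-- listing) or p (bottom-up listing).
data ChopTop (b : Bool) : List Bool → List Bool → Set where
  top  : ∀ {r} → ChopTop b r (b ∷ r)
  down : ∀ {c r′ r} → ChopTop b r′ r → ChopTop b r′ (c ∷ r)

data Chop (b : Bool) : List Bool → List Bool → Set where
  root : ∀ {s} → Chop b [] (b ∷ s)
  up   : ∀ {c p s} → Chop b p s → Chop b (c ∷ p) (c ∷ s)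

∈-stalkᵀ⁺ : ∀ {b r′ r} → ChopTop b r′ r → stalkᵀ r′ ∈ options b (stalkᵀ r)
∈-stalkᵀ⁺ {true}  top                = here refl
∈-stalkᵀ⁺ {false} top                = here refl
∈-stalkᵀ⁺ {true}  (down {true}  c)   = there (∈-stalkᵀ⁺ c)
∈-stalkᵀ⁺ {true}  (down {false} c)   = ∈-stalkᵀ⁺ c
∈-stalkᵀ⁺ {false} (down {true}  c)   = ∈-stalkᵀ⁺ c
∈-stalkᵀ⁺ {false} (down {false} c)   = there (∈-stalkᵀ⁺ c)

data StalkᵀOption (b : Bool) (r : List Bool) : Game → Set where
  choppedᵀ : ∀ {r′} → ChopTop b r′ r → StalkᵀOption b r (stalkᵀ r′)

chopDown : ∀ {b c r X} → StalkᵀOption b r X → StalkᵀOption b (c ∷ r) X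
chopDown (choppedᵀ c) = choppedᵀ (down c)

∈-stalkᵀ⁻ : ∀ b r {X} → X ∈ options b (stalkᵀ r) → StalkᵀOption b r X
∈-stalkᵀ⁻ true  (true  ∷ r) (here refl) = choppedᵀ top
∈-stalkᵀ⁻ false (false ∷ r) (here refl) = choppedᵀ top
∈-stalkᵀ⁻ true  (true  ∷ r) (there m)   = chopDown (∈-stalkᵀ⁻ true r m)
∈-stalkᵀ⁻ false (false ∷ r) (there m)   = chopDown (∈-stalkᵀ⁻ false r m)
∈-stalkᵀ⁻ true  (false ∷ r) m           = chopDown (∈-stalkᵀ⁻ true r m)
∈-stalkᵀ⁻ false (true  ∷ r) m           = chopDown (∈-stalkᵀ⁻ false r m)

chopTop-∷ʳ : ∀ {b} d → ChopTop b [] (d ∷ʳ b)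
chopTop-∷ʳ []      = top
chopTop-∷ʳ (c ∷ d) = down (chopTop-∷ʳ d)

chopTop-∷ʳ-mono : ∀ {b r′ r} c → ChopTop b r′ r → ChopTop b (r′ ∷ʳ c) (r ∷ʳ c)
chopTop-∷ʳ-mono c top      = top
chopTop-∷ʳ-mono c (down x) = down (chopTop-∷ʳ-mono c x)

chop-∷ʳ : ∀ {b} q → Chop b q (q ∷ʳ b)
chop-∷ʳ []      = root
chop-∷ʳ (c ∷ q) = up (chop-∷ʳ q)

chop-++ : ∀ {b p s} e → Chop b p s → Chop b p (s ++ e)
chop-++ e root   = root
chop-++ e (up x) = up (chop-++ e x)

chop⇒chopTop : ∀ {b p s} → Chop b p s → ChopTop b (reverse p) (reverse s)
chop⇒chopTop {b} (root {s}) rewrite unfold-reverse b s = chopTop-∷ʳ (reverse s)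
chop⇒chopTop (up {c} {p} {s} x) rewrite unfold-reverse c p | unfold-reverse c s =
  chopTop-∷ʳ-mono c (chop⇒chopTop x)

chopTop⇒chop : ∀ {b r′ r} → ChopTop b r′ r → Chop b (reverse r′) (reverse r)
chopTop⇒chop {b} (top {r}) rewrite unfold-reverse b r = chop-∷ʳ (reverse r)
chopTop⇒chop (down {c} {_} {r} x) rewrite unfold-reverse c r = chop-++ (c ∷ []) (chopTop⇒chop x)

∈-stalk⁺ : ∀ {b p s} → Chop b p s → stalk p ∈ options b (stalk s)
∈-stalk⁺ c = ∈-stalkᵀ⁺ (chop⇒chopTop c)

data StalkOption (b : Bool) (s : List Bool) : Game → Set where
  chopped : ∀ {p} → Chop b p s → StalkOption b s (stalk p)

∈-stalk⁻ : ∀ b s {X} → X ∈ options b (stalk s) → StalkOption b s X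
∈-stalk⁻ b s m with ∈-stalkᵀ⁻ b (reverse s) m
... | choppedᵀ {r′} c =
  subst (StalkOption b s) (cong stalkᵀ (reverse-involutive r′))
        (chopped (subst (Chop b (reverse r′)) (reverse-involutive s) (chopTop⇒chop c)))

-- Sign expansions

infix 4 _<ˢ_ _≤ˢ_

data _<ˢ_ : List Bool → List Bool → Set where
  []<true    : ∀ {t} → [] <ˢ true ∷ t
  false<[]   : ∀ {s} → false ∷ s <ˢ []
  false<true : ∀ {s t} → false ∷ s <ˢ true ∷ t
  ∷<∷        : ∀ {c s t} → s <ˢ t → c ∷ s <ˢ c ∷ t

<ˢ-trans : ∀ {r s t} → r <ˢ s → s <ˢ t → r <ˢ t
<ˢ-trans []<true    (∷<∷ _)    = []<true
<ˢ-trans false<[]   []<true    = false<true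
<ˢ-trans false<true (∷<∷ _)    = false<true
<ˢ-trans (∷<∷ _)    false<[]   = false<[]
<ˢ-trans (∷<∷ _)    false<true = false<true
<ˢ-trans (∷<∷ r<s)  (∷<∷ s<t)  = ∷<∷ (<ˢ-trans r<s s<t)

module ≤ˢ = StrictToNonStrict _≡_ _<ˢ_

_≤ˢ_ : List Bool → List Bool → Set
_≤ˢ_ = ≤ˢ._≤_

<-≤ˢ-trans : ∀ {r s t} → r <ˢ s → s ≤ˢ t → r <ˢ t
<-≤ˢ-trans = ≤ˢ.<-≤-trans <ˢ-trans (respʳ _<ˢ_)

≤-<ˢ-trans : ∀ {r s t} → r ≤ˢ s → s <ˢ t → r <ˢ t
≤-<ˢ-trans = ≤ˢ.≤-<-trans sym <ˢ-trans (respˡ _<ˢ_)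

∷-≤ˢ : ∀ {c s t} → s ≤ˢ t → c ∷ s ≤ˢ c ∷ t
∷-≤ˢ (inj₁ s<t)  = inj₁ (∷<∷ s<t)
∷-≤ˢ (inj₂ refl) = inj₂ refl

<ˢ-total : ∀ s t → s <ˢ t ⊎ t ≤ˢ s
<ˢ-total []          []          = inj₂ (inj₂ refl)
<ˢ-total []          (true ∷ t)  = inj₁ []<true
<ˢ-total []          (false ∷ t) = inj₂ (inj₁ false<[])
<ˢ-total (true ∷ s)  []          = inj₂ (inj₁ []<true)
<ˢ-total (false ∷ s) []          = inj₁ false<[]
<ˢ-total (true ∷ s)  (false ∷ t) = inj₂ (inj₁ false<true)
<ˢ-total (false ∷ s) (true ∷ t)  = inj₁ false<true
<ˢ-total (true ∷ s)  (true ∷ t)  = Sum.map ∷<∷ ∷-≤ˢ (<ˢ-total s t)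
<ˢ-total (false ∷ s) (false ∷ t) = Sum.map ∷<∷ ∷-≤ˢ (<ˢ-total s t)

chop-true-< : ∀ {p s} → Chop true p s → p <ˢ s
chop-true-< root   = []<true
chop-true-< (up c) = ∷<∷ (chop-true-< c)

chop-false-> : ∀ {p s} → Chop false p s → s <ˢ p
chop-false-> root   = false<[]
chop-false-> (up c) = ∷<∷ (chop-false-> c)

chop-length : ∀ {b p s} → Chop b p s → length p < length s
chop-length root   = z<s
chop-length (up c) = s<s (chop-length c)

<ˢ⇒chop : ∀ {r t} → r <ˢ t →
  (Σ (List Bool) λ p → Chop true p t × r ≤ˢ p) ⊎ (Σ (List Bool) λ p → Chop false p r × p ≤ˢ t)
<ˢ⇒chop []<true    = inj₁ ([] , root , inj₂ refl)
<ˢ⇒chop false<[]   = inj₂ ([] , root , inj₂ refl)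
<ˢ⇒chop false<true = inj₁ ([] , root , inj₁ false<[])
<ˢ⇒chop (∷<∷ r<t)  with <ˢ⇒chop r<t
... | inj₁ (p , c , r≤p) = inj₁ (_ ∷ p , up c , ∷-≤ˢ r≤p)
... | inj₂ (p , c , p≤t) = inj₂ (_ ∷ p , up c , ∷-≤ˢ p≤t)

mutual
  stalk-≥′ : ∀ {r t} → Acc _<_ (length r +ℕ length t) → r ≤ˢ t → stalk t ≥G stalk r
  stalk-≥′ {r} {t} (acc rec) r≤t = ≥-intro (stalk t) (stalk r) beatLeft beatRight
    where
    beatLeft : ∀ {X} → X ∈ leftOpts (stalk r) → stalk t ⧐ X
    beatLeft m with ∈-stalk⁻ true r m
    ... | chopped c = stalk-⧐′ (rec (+-monoˡ-< (length t) (chop-length c)))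
                               (<-≤ˢ-trans (chop-true-< c) r≤t)

    beatRight : ∀ {X} → X ∈ rightOpts (stalk t) → X ⧐ stalk r
    beatRight m with ∈-stalk⁻ false t m
    ... | chopped c = stalk-⧐′ (rec (+-monoʳ-< (length r) (chop-length c)))
                               (≤-<ˢ-trans r≤t (chop-false-> c))

  stalk-⧐′ : ∀ {r t} → Acc _<_ (length r +ℕ length t) → r <ˢ t → stalk t ⧐ stalk r
  stalk-⧐′ {r} {t} (acc rec) r<t with <ˢ⇒chop r<t
  ... | inj₁ (p , c , r≤p) = ⧐-via-leftOpt (stalk t) (stalk r) (∈-stalk⁺ c)
                               (stalk-≥′ (rec (+-monoʳ-< (length r) (chop-length c))) r≤p)
  ... | inj₂ (p , c , p≤t) = ⧐-via-rightOpt (stalk t) (stalk r) (∈-stalk⁺ c)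
                               (stalk-≥′ (rec (+-monoˡ-< (length t) (chop-length c))) p≤t)

stalk-≥ : ∀ {r t} → r ≤ˢ t → stalk t ≥G stalk r
stalk-≥ = stalk-≥′ (<-wellFounded _)

stalk-⧐ : ∀ {r t} → r <ˢ t → stalk t ⧐ stalk r
stalk-⧐ = stalk-⧐′ (<-wellFounded _)

simplestBelow : ∀ h → Σ (List Bool) λ s →
  s <ˢ h × (∀ {p} → ¬ Chop true p s) × (∀ {p} → Chop false p s → h ≤ˢ p)
simplestBelow []          =
  false ∷ [] , false<[] , (λ { (up ()) }) , λ { root → inj₂ refl ; (up ()) }
simplestBelow (true ∷ h)  = [] , []<true , (λ ()) , (λ ())
simplestBelow (false ∷ h) with simplestBelow h
... | s , s<h , noLeft , right =
  false ∷ s , ∷<∷ s<h , (λ { (up c) → noLeft c }) ,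
  λ { root → inj₁ false<[] ; (up c) → ∷-≤ˢ (right c) }

simplestAbove : ∀ l → Σ (List Bool) λ s →
  l <ˢ s × (∀ {p} → Chop true p s → p ≤ˢ l) × (∀ {p} → ¬ Chop false p s)
simplestAbove []          =
  true ∷ [] , []<true , (λ { root → inj₂ refl ; (up ()) }) , λ { (up ()) }
simplestAbove (false ∷ l) = [] , false<[] , (λ ()) , (λ ())
simplestAbove (true ∷ l)  with simplestAbove l
... | s , l<s , left , noRight =
  true ∷ s , ∷<∷ l<s , (λ { root → inj₁ []<true ; (up c) → ∷-≤ˢ (left c) }) ,
  λ { (up c) → noRight c }

simplestBetween : ∀ {l h} → l <ˢ h → Σ (List Bool) λ s →
  l <ˢ s × s <ˢ h × (∀ {p} → Chop true p s → p ≤ˢ l) × (∀ {p} → Chop false p s → h ≤ˢ p)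
simplestBetween ([]<true {h}) with simplestBelow h
... | s , s<h , noLeft , right =
  true ∷ s , []<true , ∷<∷ s<h , (λ { root → inj₂ refl ; (up c) → ⊥-elim (noLeft c) }) ,
  λ { (up c) → ∷-≤ˢ (right c) }
simplestBetween (false<[] {l}) with simplestAbove l
... | s , l<s , left , noRight =
  false ∷ s , ∷<∷ l<s , false<[] , (λ { (up c) → ∷-≤ˢ (left c) }) ,
  λ { root → inj₂ refl ; (up c) → ⊥-elim (noRight c) }
simplestBetween false<true = [] , false<[] , []<true , (λ ()) , (λ ())
simplestBetween (∷<∷ {true} l<h) with simplestBetween l<h
... | s , l<s , s<h , left , right =
  true ∷ s , ∷<∷ l<s , ∷<∷ s<h , (λ { root → inj₁ []<true ; (up c) → ∷-≤ˢ (left c) }) ,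
  λ { (up c) → ∷-≤ˢ (right c) }
simplestBetween (∷<∷ {false} l<h) with simplestBetween l<h
... | s , l<s , s<h , left , right =
  false ∷ s , ∷<∷ l<s , ∷<∷ s<h , (λ { (up c) → ∷-≤ˢ (left c) }) ,
  λ { root → inj₁ false<[] ; (up c) → ∷-≤ˢ (right c) }

open import Relation.Nullary.Construct.Add.Infimum using (_₋; ⊥₋; [_])
open import Relation.Nullary.Construct.Add.Supremum using (_⁺; ⊤⁺)
import Relation.Binary.Construct.Add.Infimum.Strict _<ˢ_ as Inf
import Relation.Binary.Construct.Add.Infimum.NonStrict _≤ˢ_ as Inf≤
import Relation.Binary.Construct.Add.Supremum.Strict _<ˢ_ as Sup
import Relation.Binary.Construct.Add.Supremum.NonStrict _≤ˢ_ as Sup≤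
open Inf using (_<₋_)
open Inf≤ using (_≤₋_)
open Sup using (_<⁺_)
open Sup≤ using (_≤⁺_)

Separated : List Bool ₋ → List Bool ⁺ → Set
Separated [ l ] [ h ] = l <ˢ h
Separated _     _     = ⊤

-- Every proper prefix of s lies outside the interval (lo, hi).
record SimplestBetween (lo : List Bool ₋) (hi : List Bool ⁺) (s : List Bool) : Set where
  field
    lo<s       : lo <₋ [ s ]
    s<hi       : [ s ] <⁺ hi
    leftChops  : ∀ {p} → Chop true p s → [ p ] ≤₋ lo
    rightChops : ∀ {p} → Chop false p s → hi ≤⁺ [ p ]

simplest : ∀ lo hi → Separated lo hi → Σ (List Bool) (SimplestBetween lo hi)
simplest ⊥₋ ⊤⁺ _ = [] , record
  { lo<s       = Inf.⊥₋<[ [] ]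
  ; s<hi       = Sup.[ [] ]<⊤⁺
  ; leftChops  = λ ()
  ; rightChops = λ () }
simplest ⊥₋ [ h ] _ with simplestBelow h
... | s , s<h , noLeft , right = s , record
  { lo<s       = Inf.⊥₋<[ s ]
  ; s<hi       = Sup.[ s<h ]
  ; leftChops  = λ c → ⊥-elim (noLeft c)
  ; rightChops = λ c → Sup≤.[ right c ] }
simplest [ l ] ⊤⁺ _ with simplestAbove l
... | s , l<s , left , noRight = s , record
  { lo<s       = Inf.[ l<s ]
  ; s<hi       = Sup.[ s ]<⊤⁺
  ; leftChops  = λ c → Inf≤.[ left c ]
  ; rightChops = λ c → ⊥-elim (noRight c) }
simplest [ l ] [ h ] l<h with simplestBetween l<h
... | s , l<s , s<h , left , right = s , record
  { lo<s       = Inf.[ l<s ]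
  ; s<hi       = Sup.[ s<h ]
  ; leftChops  = λ c → Inf≤.[ left c ]
  ; rightChops = λ c → Sup≤.[ right c ] }

-- Every number is a stalk

EqualsStalk : Game → Set
EqualsStalk x = Σ (List Bool) λ s → x ≃ stalk s

-- lo stands for the greatest string of a Left option, ⊥₋ if there is none.
record LeftBound (ls : List Game) (lo : List Bool ₋) : Set where
  field
    below     : ∀ {a s} → a ∈ ls → lo <₋ [ s ] → stalk s ⧐ a
    dominated : ∀ {p} → [ p ] ≤₋ lo → Σ Game λ a → a ∈ ls × a ≥G stalk p

record RightBound (rs : List Game) (hi : List Bool ⁺) : Set where
  field
    above      : ∀ {b s} → b ∈ rs → [ s ] <⁺ hi → b ⧐ stalk s
    dominating : ∀ {p} → hi ≤⁺ [ p ] → Σ Game λ b → b ∈ rs × stalk p ≥G b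

<₋-total : ∀ lo s → lo <₋ [ s ] ⊎ [ s ] ≤₋ lo
<₋-total ⊥₋    s = inj₁ Inf.⊥₋<[ s ]
<₋-total [ l ] s = Sum.map Inf.[_] Inf≤.[_] (<ˢ-total l s)

<⁺-total : ∀ s hi → [ s ] <⁺ hi ⊎ hi ≤⁺ [ s ]
<⁺-total s ⊤⁺    = inj₁ Sup.[ s ]<⊤⁺
<⁺-total s [ h ] = Sum.map Sup.[_] Sup≤.[_] (<ˢ-total s h)

stalk-⧐-≃ : ∀ {a sa s} → a ≃ stalk sa → sa <ˢ s → stalk s ⧐ a
stalk-⧐-≃ (_ , sa≥a) sa<s = ⧐-≥-trans (stalk-⧐ sa<s) sa≥a

≃-⧐-stalk : ∀ {b sb s} → b ≃ stalk sb → s <ˢ sb → b ⧐ stalk s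
≃-⧐-stalk (b≥sb , _) s<sb = ≥-⧐-trans b≥sb (stalk-⧐ s<sb)

≃-≥-stalk : ∀ {a sa p} → a ≃ stalk sa → p ≤ˢ sa → a ≥G stalk p
≃-≥-stalk (a≥sa , _) p≤sa = ≥-trans a≥sa (stalk-≥ p≤sa)

stalk-≥-≃ : ∀ {b sb p} → b ≃ stalk sb → sb ≤ˢ p → stalk p ≥G b
stalk-≥-≃ (_ , sb≥b) sb≤p = ≥-trans (stalk-≥ sb≤p) sb≥b

leftBound : ∀ {ls} → All EqualsStalk ls → Σ (List Bool ₋) (LeftBound ls)
leftBound [] = ⊥₋ , record { below = λ () ; dominated = λ () }
leftBound {a ∷ _} ((sa , a≃sa) ∷ eqs) with leftBound eqs
... | lo , bound with <₋-total lo sa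
...   | inj₁ lo<sa = [ sa ] , record
  { below     = λ { (here refl) sa<s → stalk-⧐-≃ a≃sa (Inf.[<]-injective sa<s)
                  ; (there m)   sa<s → below m (Inf.<₋-trans <ˢ-trans lo<sa sa<s) }
  ; dominated = λ p≤sa → a , here refl , ≃-≥-stalk a≃sa (Inf≤.[≤]-injective p≤sa) }
  where open LeftBound bound
...   | inj₂ sa≤lo = lo , record
  { below     = λ { (here refl) lo<s →
                      stalk-⧐-≃ a≃sa (Inf.[<]-injective (Inf.<₋-transʳ ≤-<ˢ-trans sa≤lo lo<s))
                  ; (there m) → below m }
  ; dominated = λ p≤lo → let a′ , m , a′≥p = dominated p≤lo in a′ , there m , a′≥p }
  where open LeftBound bound

rightBound : ∀ {rs} → All EqualsStalk rs → Σ (List Bool ⁺) (RightBound rs)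
rightBound [] = ⊤⁺ , record { above = λ () ; dominating = λ () }
rightBound {b ∷ _} ((sb , b≃sb) ∷ eqs) with rightBound eqs
... | hi , bound with <⁺-total sb hi
...   | inj₁ sb<hi = [ sb ] , record
  { above      = λ { (here refl) s<sb → ≃-⧐-stalk b≃sb (Sup.[<]-injective s<sb)
                   ; (there m)   s<sb → above m (Sup.<⁺-trans <ˢ-trans s<sb sb<hi) }
  ; dominating = λ sb≤p → b , here refl , stalk-≥-≃ b≃sb (Sup≤.[≤]-injective sb≤p) }
  where open RightBound bound
...   | inj₂ hi≤sb = hi , record
  { above      = λ { (here refl) s<hi →
                       ≃-⧐-stalk b≃sb (Sup.[<]-injective (Sup.<⁺-transˡ <-≤ˢ-trans s<hi hi≤sb))
                   ; (there m) → above m }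
  ; dominating = λ hi≤p → let b′ , m , p≥b′ = dominating hi≤p in b′ , there m , p≥b′ }
  where open RightBound bound

separated : ∀ {ls rs lo hi} → LeftBound ls lo → RightBound rs hi →
            (∀ {a b} → a ∈ ls → b ∈ rs → a <G b) → Separated lo hi
separated {lo = ⊥₋}               _ _ _ = tt
separated {lo = [ _ ]} {hi = ⊤⁺}  _ _ _ = tt
separated {lo = [ l ]} {hi = [ h ]} L R a<b with <ˢ-total l h
... | inj₁ l<h = l<h
... | inj₂ h≤l =
  let a , ma , a≥l = LeftBound.dominated L Inf≤.[ inj₂ refl ]
      b , mb , h≥b = RightBound.dominating R Sup≤.[ inj₂ refl ]
  in ⊥-elim (proj₂ (a<b ma mb) (≥-trans a≥l (≥-trans (stalk-≥ h≤l) h≥b)))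

cut≃stalk : ∀ {ls rs lo hi s} → LeftBound ls lo → RightBound rs hi →
            SimplestBetween lo hi s → ⟨ ls ∣ rs ⟩ ≃ stalk s
cut≃stalk {ls} {rs} {s = s} L R S =
  ≥-intro x (stalk s) leftOfStalk (λ mb → above mb s<hi) ,
  ≥-intro (stalk s) x (λ ma → below ma lo<s) rightOfStalk
  where
  open LeftBound L
  open RightBound R
  open SimplestBetween S
  x = ⟨ ls ∣ rs ⟩

  leftOfStalk : ∀ {X} → X ∈ leftOpts (stalk s) → x ⧐ X
  leftOfStalk m with ∈-stalk⁻ true s m
  ... | chopped c = let a , ma , a≥p = dominated (leftChops c) in ⧐-via-leftOpt x _ ma a≥p

  rightOfStalk : ∀ {X} → X ∈ rightOpts (stalk s) → X ⧐ x
  rightOfStalk m with ∈-stalk⁻ false s m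
  ... | chopped c = let b , mb , p≥b = dominating (rightChops c) in ⧐-via-rightOpt _ x mb p≥b

mutual
  number≃stalk : ∀ {x} → IsNumber x → EqualsStalk x
  number≃stalk (number nls nrs a<b)
    with leftBound (numbers≃stalks nls) | rightBound (numbers≃stalks nrs)
  ... | lo , L | hi , R with simplest lo hi (separated L R a<b)
  ... | s , S = s , cut≃stalk L R S

  numbers≃stalks : ∀ {gs} → All IsNumber gs → All EqualsStalk gs
  numbers≃stalks []       = []
  numbers≃stalks (n ∷ ns) = number≃stalk n ∷ numbers≃stalks ns

-- Stalks as digraph placement games

T⇒≡true : ∀ {b} → T b → b ≡ true
T⇒≡true = Equivalence.to T-≡

¬T⇒≡false : ∀ {b} → ¬ T b → b ≡ false
¬T⇒≡false {true}  ¬t = ⊥-elim (¬t tt)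
¬T⇒≡false {false} _  = refl

colourOf : Bool → Colour
colourOf true  = blue
colourOf false = red

colourOf-==C⁻ : ∀ b c → T (colourOf b ==C colourOf c) → b ≡ c
colourOf-==C⁻ true  true  _ = refl
colourOf-==C⁻ false false _ = refl

colourOf-==C⁺ : ∀ b → T (colourOf b ==C colourOf b)
colourOf-==C⁺ true  = tt
colourOf-==C⁺ false = tt

-- Vertex i is the i-th edge from the ground; playing it deletes it and everything above.
stalkDigraph : List Bool → Digraph
stalkDigraph s = record
  { n = length s ; colour = λ v → colourOf (lookup s v) ; arc = λ v u → toℕ v ≤ᵇ toℕ u }

chop-take⁺ : ∀ s {k} (i : Fin (length s)) → toℕ i < k →
             Chop (lookup s i) (take (toℕ i) s) (take k s)
chop-take⁺ (c ∷ s) {suc k} Fin.zero    _         = root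
chop-take⁺ (c ∷ s) {suc k} (Fin.suc i) (s<s i<k) = up (chop-take⁺ s i i<k)

chop-take⁻ : ∀ s k {b p} → Chop b p (take k s) →
             Σ (Fin (length s)) λ i → toℕ i < k × p ≡ take (toℕ i) s × lookup s i ≡ b
chop-take⁻ (c ∷ s) (suc k) root   = Fin.zero , z<s , refl , refl
chop-take⁻ (c ∷ s) (suc k) (up x) with chop-take⁻ s k x
... | i , i<k , refl , refl = Fin.suc i , s<s i<k , refl , refl

module StalkDigraph (s : List Bool) where

  D = stalkDigraph s
  N = length s

  firstVertices : ℕ → Vec Bool N
  firstVertices k = tabulate λ u → toℕ u <ᵇ k

  delete-firstVertices : ∀ {k} v → toℕ v < k →
                         delete D v (firstVertices k) ≡ firstVertices (toℕ v)
  delete-firstVertices {k} v v<k = tabulate-cong survives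
    where
    survives : ∀ u → Vec.lookup (firstVertices k) u ∧ not (does (u ≟ᶠ v) ∨ (toℕ v ≤ᵇ toℕ u))
                     ≡ (toℕ u <ᵇ toℕ v)
    survives u rewrite lookup∘tabulate (λ u → toℕ u <ᵇ k) u with toℕ u <? toℕ v
    ... | yes u<v rewrite T⇒≡true (<⇒<ᵇ (<-trans u<v v<k)) | T⇒≡true (<⇒<ᵇ u<v)
                        | dec-false (u ≟ᶠ v) (<⇒≢ u<v)
                        | ¬T⇒≡false (λ v≤u → <⇒≱ u<v (≤ᵇ⇒≤ (toℕ v) (toℕ u) v≤u)) = refl
    ... | no u≮v  rewrite T⇒≡true (≤⇒≤ᵇ (≮⇒≥ u≮v)) | ∨-zeroʳ (does (u ≟ᶠ v))
                        | ¬T⇒≡false (λ u<v → u≮v (<ᵇ⇒< (toℕ u) (toℕ v) u<v)) = ∧-zeroʳ _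

  canPlay : Colour → Vec Bool N → Fin N → Bool
  canPlay c S v = Vec.lookup S v ∧ (colourOf (lookup s v) ==C c)

  ∈-playable⁺ : ∀ {k} v → toℕ v < k → v ∈ playable D (colourOf (lookup s v)) (firstVertices k)
  ∈-playable⁺ {k} v v<k =
    ∈-filter⁺ (λ u → T? (canPlay (colourOf (lookup s v)) (firstVertices k) u)) (∈-allFin v)
      (Equivalence.from T-∧ ( subst T (sym (lookup∘tabulate _ v)) (<⇒<ᵇ v<k)
                            , colourOf-==C⁺ (lookup s v)))

  ∈-playable⁻ : ∀ {b k v} → v ∈ playable D (colourOf b) (firstVertices k) →
                toℕ v < k × lookup s v ≡ b
  ∈-playable⁻ {b} {k} {v} m
    with ∈-filter⁻ (λ u → T? (canPlay (colourOf b) (firstVertices k) u)) {xs = allFin N} m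
  ... | _ , playable-v with Equivalence.to T-∧ playable-v
  ... | v<k , sameColour = <ᵇ⇒< (toℕ v) k (subst T (lookup∘tabulate _ v) v<k)
                         , colourOf-==C⁻ (lookup s v) b sameColour

  move : ℕ → Vec Bool N → Fin N → Game
  move f S v = position D f (delete D v S)

  options-position : ∀ b f S →
                     options b (position D (suc f) S) ≡ map (move f S) (playable D (colourOf b) S)
  options-position true  f S = refl
  options-position false f S = refl

  position∼stalk : ∀ f k → k ≤ f → position D f (firstVertices k) ∼ stalk (take k s)
  position∼stalk zero    zero z≤n   = bisim (λ { true () ; false () }) (λ { true () ; false () })
  position∼stalk (suc f) k    k≤1+f = bisim forth back
    where
    P = position D (suc f) (firstVertices k)
    after = move f (firstVertices k)

    step : ∀ v → toℕ v < k → after v ∼ stalk (take (toℕ v) s)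
    step v v<k rewrite delete-firstVertices v v<k =
      position∼stalk f (toℕ v) (s≤s⁻¹ (≤-trans v<k k≤1+f))

    forth : ∀ b {P′} → P′ ∈ options b P → Σ Game λ Q′ → Q′ ∈ options b (stalk (take k s)) × P′ ∼ Q′
    forth b m with ∈-map⁻ after (subst (_ ∈_) (options-position b f (firstVertices k)) m)
    ... | v , mv , refl with ∈-playable⁻ mv
    ... | v<k , refl = _ , ∈-stalk⁺ (chop-take⁺ s v v<k) , step v v<k

    back : ∀ b {Q′} → Q′ ∈ options b (stalk (take k s)) → Σ Game λ P′ → P′ ∈ options b P × P′ ∼ Q′
    back b m with ∈-stalk⁻ b (take k s) m
    ... | chopped c with chop-take⁻ s k c
    ... | i , i<k , refl , refl =
      after i ,
      subst (after i ∈_) (sym (options-position _ f (firstVertices k))) (∈-map⁺ after (∈-playable⁺ i i<k)) ,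
      step i i<k

  firstVertices-all : replicate N true ≡ firstVertices N
  firstVertices-all =
    trans (sym (tabulate∘lookup (replicate N true)))
          (tabulate-cong λ i → trans (lookup-replicate i true) (sym (T⇒≡true (<⇒<ᵇ (toℕ<n i)))))

  digraph∼stalk : digraphGame D ∼ stalk s
  digraph∼stalk rewrite firstVertices-all =
    subst (λ t → position D N (firstVertices N) ∼ stalk t) (take-all N s ≤-refl)
          (position∼stalk N N ≤-refl)

lemma5 : (x : Game) → IsNumber x → Σ Digraph (λ D → digraphGame D ≈G x)
lemma5 x x-number =
  let s , x≃s = number≃stalk x-number
  in stalkDigraph s , ≃⇒≈ (≃-trans (∼⇒≃ (StalkDigraph.digraph∼stalk s)) (≃-sym x≃s))
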